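{- Let $G$ be a connected graph. Then $W_\epsilon(G)\geq\frac{\varepsilon^*(G)}{2}$. Equality holds if $G$ is a cycle of even length.
   Context: Graphs are finite, simple, undirected. For a connected graph $G$ with vertices $v_1,\ldots,v_p$, $d(v_i,v_j)$ is the distance and $e(v_i)=\max_j d(v_i,v_j)$ the eccentricity. The eccentricity matrix $\epsilon(G)$ has $(i,j)$ entry $d(v_i,v_j)$ if $d(v_i,v_j)=\min\{e(v_i),e(v_j)\}$ and $0$ otherwise. $W_\epsilon(G)=\frac12\sum_{i,j}(\epsilon(G))_{ij}$ is the eccentricity Wiener index and $\varepsilon^*(G)=\sum_{i=1}^p e(v_i)$ is the total eccentricity. -}

module Defs where

open import Data.Nat using (ℕ; zero; suc; _+_; _*_; _⊔_; _⊓_; _≡ᵇ_; _<ᵇ_)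
open import Data.Nat.DivMod using (_%_)
open import Data.Bool using (Bool; true; false; _∧_; _∨_; if_then_else_)
open import Data.Fin using (Fin; toℕ)
open import Data.List using (List; foldr; map; allFin; concatMap)
open import Data.Nat.ListAction using (sum)
open import Data.Bool.ListAction using (any)
open import Data.Product using (Σ; ∃; _×_)
open import Function.Bundles using (_↔_; Inverse)
open import Relation.Binary.PropositionalEquality using (_≡_)

record Graph (p : ℕ) : Set where
  field
    adj     : Fin p → Fin p → Bool
    adj-sym : ∀ u v → adj u v ≡ adj v u
    irrefl  : ∀ u → adj u u ≡ false
open Graph public

module _ {p : ℕ} (G : Graph p) where

  within : ℕ → Fin p → Fin p → Bool
  within zero    u v = toℕ u ≡ᵇ toℕ v
  within (suc k) u v = within k u v ∨ any (λ w → within k u w ∧ adj G w v) (allFin p)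

  Connected : Set
  Connected = ∀ u v → ∃ λ k → within k u v ≡ true

-- least k < n with f k ≡ true, or n if there is none
search : ℕ → (ℕ → Bool) → ℕ
search zero    f = zero
search (suc n) f = if f zero then zero else suc (search n (λ k → f (suc k)))

module _ {p : ℕ} (G : Graph p) where

  -- shortest-path distance d(u,v) (for a connected graph it is < p)
  dist : Fin p → Fin p → ℕ
  dist u v = search p (λ k → within G k u v)

  ecc : Fin p → ℕ
  ecc u = foldr _⊔_ 0 (map (dist u) (allFin p))

  eccMat : Fin p → Fin p → ℕ
  eccMat u v = if dist u v ≡ᵇ (ecc u ⊓ ecc v) then dist u v else 0

  totalEcc : ℕ
  totalEcc = sum (map ecc (allFin p))

  -- eccentricity Wiener index W_ε(G) = ½ Σ_{i,j} ε_ij, written as the sum over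
  -- pairs i < j (ε(G) is symmetric with zero diagonal, so this is exactly half)
  Wecc : ℕ
  Wecc = sum (concatMap (λ u → map (λ v → if toℕ u <ᵇ toℕ v then eccMat u v else 0) (allFin p)) (allFin p))

cycleAdj : (n : ℕ) → Fin n → Fin n → Bool
cycleAdj zero    i j = false
cycleAdj (suc m) i j =
  (toℕ j ≡ᵇ (suc (toℕ i) % suc m)) ∨ (toℕ i ≡ᵇ (suc (toℕ j) % suc m))

-- G is (isomorphic to) a cycle of even length p = 2(m+2) ≥ 4
IsEvenCycle : {p : ℕ} → Graph p → Set
IsEvenCycle {p} G =
  Σ ℕ λ m → Σ (p ≡ 2 * suc (suc m)) λ _ →
    Σ (Fin p ↔ Fin p) λ σ →
      ∀ u v → adj G u v ≡ cycleAdj p (Inverse.to σ u) (Inverse.to σ v)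

{-# OPTIONS --safe #-}
-- Every vertex u has an eccentric vertex v, d(u,v) = e(u). Since d(u,v) = d(v,u) ≤ e(v), also
-- min(e(u), e(v)) = d(u,v), so row u of ε(G) contains the entry e(u) and its sum is at least
-- e(u); summing over u gives 2 W_ε(G) ≥ ε*(G), with equality as soon as that is the only
-- nonzero entry of every row. On an even cycle C_{2h} with vertices at positions i and j,
-- d = min(|i - j|, 2h - |i - j|): the two arcs bound d from above, and no walk does better
-- because one step changes this quantity by at most one. So every vertex has eccentricity h,
-- reached only at its antipode, and every other entry of row u has d < h = min(e(u), e(v)).
module Submission where

open import Defs
open import Data.Bool using (Bool; true; false; T; if_then_else_)
open import Data.Bool.Properties using (T-∨; T-∧)
open import Data.Empty using (⊥-elim)
open import Data.Fin using (Fin; toℕ; fromℕ<; zero; suc; punchIn)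
open import Data.Fin.Properties using (toℕ-injective; toℕ<n; toℕ-fromℕ<; punchInᵢ≢i)
open import Data.List using (List; []; _∷_; foldr; map; allFin; concatMap; tabulate)
open import Data.List.Membership.Propositional using (_∈_; lose)
open import Data.List.Membership.Propositional.Properties using (∈-allFin; ∈-map⁺; ∈-map⁻; foldr-selective)
open import Data.List.Properties using (foldr-preservesᵒ)
open import Data.List.Relation.Unary.Any using (satisfied)
open import Data.List.Relation.Unary.Any.Properties using (any⁺; any⁻)
open import Data.Nat using (ℕ; zero; suc; _+_; _*_; _∸_; _⊔_; _⊓_; _≤_; _<_; _≟_; _<?_; _<ᵇ_; s≤s; s≤s⁻¹; z≤n; ∣_-_∣; NonZero)
open import Data.Nat.DivMod using (_%_; m≤n⇒m%n≡m; n%n≡0; m%n<n; m%n%n≡m%n; %-distribˡ-+; [m+n]%n≡m%n)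
open import Data.Nat.ListAction using (sum)
open import Data.Nat.ListAction.Properties using (sum-++)
open import Data.Nat.Properties
open import Algebra.Properties.CommutativeMonoid.Sum +-0-commutativeMonoid
  using (sum-remove; sum-cong-≗; sum-replicate-zero; ∑-distrib-+; ∑-comm)
  renaming (sum to ∑)
open import Data.Product using (∃-syntax; _×_; _,_; proj₁)
open import Data.Sum using (_⊎_; inj₁; inj₂)
open import Function using (_∘_; id; _⇔_; mk⇔; Equivalence; _↔_; Inverse; Injection)
open import Function.Properties.Inverse using (↔⇒↣)
open import Relation.Binary.PropositionalEquality
open import Relation.Binary using (tri<; tri≈; tri>)
open import Relation.Nullary using (¬_; yes; no)
open import Relation.Nullary.Decidable using (dec-true; dec-false)

sum-map-tabulate : ∀ {A : Set} {n} (f : A → ℕ) (g : Fin n → A) → sum (map f (tabulate g)) ≡ ∑ (f ∘ g)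
sum-map-tabulate {n = zero}  f g = refl
sum-map-tabulate {n = suc n} f g = cong (f (g zero) +_) (sum-map-tabulate f (g ∘ suc))

sum-concatMap : ∀ {A : Set} (f : A → List ℕ) xs → sum (concatMap f xs) ≡ sum (map (sum ∘ f) xs)
sum-concatMap f []       = refl
sum-concatMap f (x ∷ xs) = trans (sum-++ (f x) (concatMap f xs)) (cong (sum (f x) +_) (sum-concatMap f xs))

entry≤∑ : ∀ {n} (f : Fin n → ℕ) i → f i ≤ ∑ f
entry≤∑ {suc n} f i = ≤-trans (m≤m+n (f i) _) (≤-reflexive (sym (sum-remove {i = i} f)))

∑-supported-at : ∀ {n} (f : Fin n → ℕ) a → (∀ i → i ≢ a → f i ≡ 0) → ∑ f ≡ f a
∑-supported-at {suc n} f a f≡0 = begin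
  ∑ f                           ≡⟨ sum-remove {i = a} f ⟩
  f a + ∑ (f ∘ punchIn a)       ≡⟨ cong (f a +_) (sum-cong-≗ (λ j → f≡0 (punchIn a j) (punchInᵢ≢i a j))) ⟩
  f a + ∑ {n} (λ _ → 0)         ≡⟨ cong (f a +_) (sum-replicate-zero n) ⟩
  f a + 0                       ≡⟨ +-identityʳ (f a) ⟩
  f a                           ∎
  where open ≡-Reasoning

≤-foldr-⊔ : ∀ {x xs} → x ∈ xs → x ≤ foldr _⊔_ 0 xs
≤-foldr-⊔ {x} {xs} x∈xs = foldr-preservesᵒ {P = x ≤_} ≤-⊔ 0 xs (inj₂ (lose x∈xs ≤-refl))
  where
  ≤-⊔ : ∀ a b → x ≤ a ⊎ x ≤ b → x ≤ a ⊔ b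
  ≤-⊔ a b (inj₁ x≤a) = m≤n⇒m≤n⊔o b x≤a
  ≤-⊔ a b (inj₂ x≤b) = m≤n⇒m≤o⊔n a x≤b

∑-mono-≤ : ∀ {n} {f g : Fin n → ℕ} → (∀ i → f i ≤ g i) → ∑ f ≤ ∑ g
∑-mono-≤ {zero}  f≤g = z≤n
∑-mono-≤ {suc n} f≤g = +-mono-≤ (f≤g zero) (∑-mono-≤ (f≤g ∘ suc))

≡-from-T⇔ : ∀ {a b} → T a ⇔ T b → a ≡ b
≡-from-T⇔ {false} {false} _   = refl
≡-from-T⇔ {false} {true}  a⇔b = ⊥-elim (Equivalence.from a⇔b _)
≡-from-T⇔ {true}  {false} a⇔b = ⊥-elim (Equivalence.to a⇔b _)
≡-from-T⇔ {true}  {true}  _   = refl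

search-cong : ∀ n {f g : ℕ → Bool} → (∀ k → f k ≡ g k) → search n f ≡ search n g
search-cong zero    f≡g = refl
search-cong (suc n) {f} {g} f≡g rewrite f≡g 0 =
  cong (λ s → if g 0 then 0 else suc s) (search-cong n (f≡g ∘ suc))

search-≤ : ∀ n (f : ℕ → Bool) k → T (f k) → search n f ≤ k
search-≤ zero    f k       fk = z≤n
search-≤ (suc n) f zero    fk with f zero
... | true  = z≤n
... | false = ⊥-elim fk
search-≤ (suc n) f (suc k) fk with f zero
... | true  = z≤n
... | false = s≤s (search-≤ n (f ∘ suc) k fk)

≤-search : ∀ n {t} (f : ℕ → Bool) → (∀ k → T (f k) → t ≤ k) → t ≤ n → t ≤ search n f
≤-search n       {zero}  f t≤k t≤n = z≤n
≤-search (suc n) {suc t} f t≤k (s≤s t≤n) with f zero | t≤k zero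
... | true  | t≤0 = ⊥-elim (<⇒≱ (s≤s z≤n) (t≤0 _))
... | false | _   = s≤s (≤-search n (f ∘ suc) (λ k fk → s≤s⁻¹ (t≤k (suc k) fk)) t≤n)

module _ {p : ℕ} (G : Graph p) where

  within-refl : ∀ u → T (within G 0 u u)
  within-refl u = ≡⇒≡ᵇ (toℕ u) (toℕ u) refl

  within-zero⁻ : ∀ {u v} → T (within G 0 u v) → u ≡ v
  within-zero⁻ {u} {v} uv = toℕ-injective (≡ᵇ⇒≡ (toℕ u) (toℕ v) uv)

  within-suc⁺ : ∀ {k u v} → T (within G k u v) → T (within G (suc k) u v)
  within-suc⁺ uv = Equivalence.from T-∨ (inj₁ uv)

  within-snoc : ∀ {k u w v} → T (within G k u w) → T (adj G w v) → T (within G (suc k) u v)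
  within-snoc {w = w} uw wv =
    Equivalence.from T-∨ (inj₂ (any⁺ _ (lose (∈-allFin w) (Equivalence.from T-∧ (uw , wv)))))

  within-suc⁻ : ∀ {k u v} → T (within G (suc k) u v) →
                T (within G k u v) ⊎ ∃[ w ] T (within G k u w) × T (adj G w v)
  within-suc⁻ uv with Equivalence.to T-∨ uv
  ... | inj₁ uv′  = inj₁ uv′
  ... | inj₂ step = let (w , uw∧wv) = satisfied (any⁻ _ (allFin p) step) in
    inj₂ (w , Equivalence.to T-∧ uw∧wv)

  within-cons : ∀ {k u w v} → T (adj G u w) → T (within G k w v) → T (within G (suc k) u v)
  within-cons {zero} {u} {w} uw wv rewrite within-zero⁻ {w} wv = within-snoc {0} {u} {u} (within-refl u) uw
  within-cons {suc k} {u} {w} {v} uw wv with within-suc⁻ {k} {w} {v} wv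
  ... | inj₁ wv′           = within-suc⁺ {suc k} {u} {v} (within-cons {k} uw wv′)
  ... | inj₂ (x , wx , xv) = within-snoc {suc k} {u} {x} (within-cons {k} uw wx) xv

  within-sym : ∀ {k u v} → T (within G k u v) → T (within G k v u)
  within-sym {zero} {u} {v} uv rewrite within-zero⁻ {u} {v} uv = within-refl v
  within-sym {suc k} {u} {v} uv with within-suc⁻ {k} {u} {v} uv
  ... | inj₁ uv′           = within-suc⁺ {k} {v} {u} (within-sym {k} {u} {v} uv′)
  ... | inj₂ (x , ux , xv) = within-cons {k} (subst T (adj-sym G x v) xv) (within-sym {k} {u} {x} ux)

  dist-≤ : ∀ {k u v} → T (within G k u v) → dist G u v ≤ k
  dist-≤ {k} {u} {v} = search-≤ p (λ l → within G l u v) k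

  ≤-dist : ∀ {t u v} → (∀ k → T (within G k u v) → t ≤ k) → t ≤ p → t ≤ dist G u v
  ≤-dist {u = u} {v} = ≤-search p (λ l → within G l u v)

  dist-sym : ∀ u v → dist G u v ≡ dist G v u
  dist-sym u v = search-cong p (λ k → ≡-from-T⇔ (mk⇔ (within-sym {k} {u} {v}) (within-sym {k} {v} {u})))

  dist-self : ∀ u → dist G u u ≡ 0
  dist-self u = n≤0⇒n≡0 (dist-≤ (within-refl u))

  dist≤ecc : ∀ u v → dist G u v ≤ ecc G u
  dist≤ecc u v = ≤-foldr-⊔ (∈-map⁺ (dist G u) (∈-allFin v))

  ecc-attained : ∀ u → ∃[ v ] dist G u v ≡ ecc G u
  ecc-attained u with foldr-selective ⊔-sel 0 (map (dist G u) (allFin p))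
  ... | inj₁ ecc≡0 = u , trans (dist-self u) (sym ecc≡0)
  ... | inj₂ ecc∈  = let (v , _ , ecc≡dist) = ∈-map⁻ (dist G u) ecc∈ in v , sym ecc≡dist

  eccMat-≡ : ∀ {u v} → dist G u v ≡ ecc G u ⊓ ecc G v → eccMat G u v ≡ dist G u v
  eccMat-≡ {u} {v} e = cong (if_then dist G u v else 0) (dec-true (dist G u v ≟ ecc G u ⊓ ecc G v) e)

  eccMat-≢ : ∀ {u v} → dist G u v ≢ ecc G u ⊓ ecc G v → eccMat G u v ≡ 0
  eccMat-≢ {u} {v} ne = cong (if_then dist G u v else 0) (dec-false (dist G u v ≟ ecc G u ⊓ ecc G v) ne)

  eccMat-< : ∀ {u v} → dist G u v < ecc G u ⊓ ecc G v → eccMat G u v ≡ 0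
  eccMat-< = eccMat-≢ ∘ <⇒≢

  eccMat-eccentric : ∀ {u v} → dist G u v ≡ ecc G u → eccMat G u v ≡ ecc G u
  eccMat-eccentric {u} {v} d≡e = trans (eccMat-≡ d≡min) d≡e
    where
    ecc≤ecc : ecc G u ≤ ecc G v
    ecc≤ecc = subst (_≤ ecc G v) (trans (dist-sym v u) d≡e) (dist≤ecc v u)
    d≡min : dist G u v ≡ ecc G u ⊓ ecc G v
    d≡min = trans d≡e (sym (m≤n⇒m⊓n≡m ecc≤ecc))

  eccMat-sym : ∀ u v → eccMat G u v ≡ eccMat G v u
  eccMat-sym u v rewrite dist-sym u v | ⊓-comm (ecc G u) (ecc G v) = refl

  eccMat-diag : ∀ u → eccMat G u u ≡ 0
  eccMat-diag u with dist G u u ≟ ecc G u ⊓ ecc G u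
  ... | yes e = trans (eccMat-≡ e) (dist-self u)
  ... | no ne = eccMat-≢ ne

  upperEccMat : Fin p → Fin p → ℕ
  upperEccMat u v = if toℕ u <ᵇ toℕ v then eccMat G u v else 0

  upperEccMat-< : ∀ {u v} → toℕ u < toℕ v → upperEccMat u v ≡ eccMat G u v
  upperEccMat-< {u} {v} u<v = cong (if_then eccMat G u v else 0) (dec-true (toℕ u <? toℕ v) u<v)

  upperEccMat-≮ : ∀ {u v} → ¬ toℕ u < toℕ v → upperEccMat u v ≡ 0
  upperEccMat-≮ {u} {v} u≮v = cong (if_then eccMat G u v else 0) (dec-false (toℕ u <? toℕ v) u≮v)

  eccMat≡upper+lower : ∀ u v → eccMat G u v ≡ upperEccMat u v + upperEccMat v u
  eccMat≡upper+lower u v with <-cmp (toℕ u) (toℕ v)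
  ... | tri< u<v _ v≮u = sym (trans (cong₂ _+_ (upperEccMat-< u<v) (upperEccMat-≮ v≮u)) (+-identityʳ _))
  ... | tri> u≮v _ v<u = sym (trans (cong₂ _+_ (upperEccMat-≮ u≮v) (upperEccMat-< v<u)) (eccMat-sym v u))
  ... | tri≈ u≮v u≡v _ rewrite toℕ-injective u≡v =
    trans (eccMat-diag v) (sym (cong₂ _+_ (upperEccMat-≮ u≮v) (upperEccMat-≮ u≮v)))

  Wecc≡∑∑upperEccMat : Wecc G ≡ ∑ (λ u → ∑ (upperEccMat u))
  Wecc≡∑∑upperEccMat = begin
    Wecc G                           ≡⟨ sum-concatMap row (allFin p) ⟩
    sum (map (sum ∘ row) (allFin p)) ≡⟨ sum-map-tabulate (sum ∘ row) id ⟩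
    ∑ (sum ∘ row)                    ≡⟨ sum-cong-≗ (λ u → sum-map-tabulate (upperEccMat u) id) ⟩
    ∑ (λ u → ∑ (upperEccMat u))      ∎
    where
    open ≡-Reasoning
    row : Fin p → List ℕ
    row u = map (upperEccMat u) (allFin p)

  ∑∑eccMat≡2*Wecc : ∑ (λ u → ∑ (eccMat G u)) ≡ 2 * Wecc G
  ∑∑eccMat≡2*Wecc = begin
    ∑ (λ u → ∑ (eccMat G u))                     ≡⟨ sum-cong-≗ (sum-cong-≗ ∘ eccMat≡upper+lower) ⟩
    ∑ (λ u → ∑ (λ v → upper u v + upper v u))    ≡⟨ sum-cong-≗ (λ u → ∑-distrib-+ (upper u) (λ v → upper v u)) ⟩
    ∑ (λ u → ∑ (upper u) + ∑ (λ v → upper v u))  ≡⟨ ∑-distrib-+ (∑ ∘ upper) (λ u → ∑ (λ v → upper v u)) ⟩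
    S + ∑ (λ u → ∑ (λ v → upper v u))            ≡⟨ cong (S +_) (∑-comm upper) ⟨
    S + S                                        ≡⟨ cong (S +_) (+-identityʳ S) ⟨
    2 * S                                        ≡⟨ cong (2 *_) Wecc≡∑∑upperEccMat ⟨
    2 * Wecc G                                   ∎
    where
    open ≡-Reasoning
    upper : Fin p → Fin p → ℕ
    upper = upperEccMat
    S : ℕ
    S = ∑ (∑ ∘ upper)

  totalEcc≡∑ecc : totalEcc G ≡ ∑ (ecc G)
  totalEcc≡∑ecc = sum-map-tabulate (ecc G) id

  ecc≤∑eccMat : ∀ u → ecc G u ≤ ∑ (eccMat G u)
  ecc≤∑eccMat u = let (v , d≡e) = ecc-attained u in
    subst (_≤ ∑ (eccMat G u)) (eccMat-eccentric d≡e) (entry≤∑ (eccMat G u) v)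

  totalEcc≤2*Wecc : totalEcc G ≤ 2 * Wecc G
  totalEcc≤2*Wecc = begin
    totalEcc G               ≡⟨ totalEcc≡∑ecc ⟩
    ∑ (ecc G)                ≤⟨ ∑-mono-≤ ecc≤∑eccMat ⟩
    ∑ (λ u → ∑ (eccMat G u)) ≡⟨ ∑∑eccMat≡2*Wecc ⟩
    2 * Wecc G               ∎
    where open ≤-Reasoning

  2*Wecc≡totalEcc : (∀ u → ∃[ a ] dist G u a ≡ ecc G u × (∀ v → v ≢ a → eccMat G u v ≡ 0)) →
                    2 * Wecc G ≡ totalEcc G
  2*Wecc≡totalEcc row-support = begin
    2 * Wecc G               ≡⟨ ∑∑eccMat≡2*Wecc ⟨
    ∑ (λ u → ∑ (eccMat G u)) ≡⟨ sum-cong-≗ rowSum≡ecc ⟩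
    ∑ (ecc G)                ≡⟨ totalEcc≡∑ecc ⟨
    totalEcc G               ∎
    where
    open ≡-Reasoning
    rowSum≡ecc : ∀ u → ∑ (eccMat G u) ≡ ecc G u
    rowSum≡ecc u = let (a , d≡e , off-a) = row-support u in
      trans (∑-supported-at (eccMat G u) a off-a) (eccMat-eccentric d≡e)

Near : ℕ → ℕ → Set
Near m n = m ≤ suc n × n ≤ suc m

near-sym : ∀ {m n} → Near m n → Near n m
near-sym (m≤1+n , n≤1+m) = n≤1+m , m≤1+n

near-suc : ∀ n → Near n (suc n)
near-suc n = m≤n⇒m≤1+n (n≤1+n n) , ≤-refl

near-⊓ : ∀ {a b c d} → Near a b → Near c d → Near (a ⊓ c) (b ⊓ d)
near-⊓ (a≤1+b , b≤1+a) (c≤1+d , d≤1+c) = ⊓-mono-≤ a≤1+b c≤1+d , ⊓-mono-≤ b≤1+a d≤1+c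

near-∸ : ∀ k {m n} → Near m n → Near (k ∸ m) (k ∸ n)
near-∸ k (m≤1+n , n≤1+m) = ∸-≤-suc n≤1+m , ∸-≤-suc m≤1+n
  where
  ∸-≤-suc : ∀ {m n} → n ≤ suc m → k ∸ m ≤ suc (k ∸ n)
  ∸-≤-suc {m} {n} n≤1+m = m≤n+o⇒m∸n≤o k m (begin
    k                 ≤⟨ m≤n+m∸n k n ⟩
    n + (k ∸ n)       ≤⟨ +-monoˡ-≤ (k ∸ n) n≤1+m ⟩
    suc m + (k ∸ n)   ≡⟨ +-suc m (k ∸ n) ⟨
    m + suc (k ∸ n)   ∎)
    where open ≤-Reasoning

∣n-1+n∣≡1 : ∀ n → ∣ n - suc n ∣ ≡ 1
∣n-1+n∣≡1 n = trans (m≤n⇒∣m-n∣≡n∸m (n≤1+n n)) (m+n∸n≡m 1 n)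

near-∣-∣ : ∀ i j → Near ∣ i - j ∣ ∣ i - suc j ∣
near-∣-∣ i j = one-step (trans (∣-∣-comm (suc j) j) (∣n-1+n∣≡1 j)) , one-step (∣n-1+n∣≡1 j)
  where
  one-step : ∀ {k l} → ∣ k - l ∣ ≡ 1 → ∣ i - l ∣ ≤ suc ∣ i - k ∣
  one-step {k} {l} ∣k-l∣≡1 = begin
    ∣ i - l ∣             ≤⟨ ∣-∣-triangle i k l ⟩
    ∣ i - k ∣ + ∣ k - l ∣ ≡⟨ cong (∣ i - k ∣ +_) ∣k-l∣≡1 ⟩
    ∣ i - k ∣ + 1         ≡⟨ +-comm ∣ i - k ∣ 1 ⟩
    suc ∣ i - k ∣         ∎
    where open ≤-Reasoning

cycleDist : ℕ → ℕ → ℕ → ℕ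
cycleDist n i j = ∣ i - j ∣ ⊓ (n ∸ ∣ i - j ∣)

cycleDist≤n : ∀ n i j → cycleDist n i j ≤ n
cycleDist≤n n i j = ≤-trans (m⊓n≤n ∣ i - j ∣ _) (m∸n≤m n ∣ i - j ∣)

near-cycleDist-suc : ∀ n i j → Near (cycleDist n i j) (cycleDist n i (suc j))
near-cycleDist-suc n i j = near-⊓ (near-∣-∣ i j) (near-∸ n (near-∣-∣ i j))

near-cycleDist-wrap : ∀ {n i} → i ≤ n → Near (cycleDist (suc n) i n) (cycleDist (suc n) i 0)
near-cycleDist-wrap {n} {i} i≤n =
  subst₂ Near (sym at-n) (sym at-0) (near-⊓ (near-sym (near-suc i)) (near-suc (n ∸ i)))
  where
  open ≡-Reasoning
  at-n : cycleDist (suc n) i n ≡ suc i ⊓ (n ∸ i)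
  at-n = begin
    ∣ i - n ∣ ⊓ (suc n ∸ ∣ i - n ∣) ≡⟨ cong (λ x → x ⊓ (suc n ∸ x)) (m≤n⇒∣m-n∣≡n∸m i≤n) ⟩
    (n ∸ i) ⊓ (suc n ∸ (n ∸ i))   ≡⟨ cong ((n ∸ i) ⊓_) (+-∸-assoc 1 (m∸n≤m n i)) ⟩
    (n ∸ i) ⊓ suc (n ∸ (n ∸ i))   ≡⟨ cong (λ x → (n ∸ i) ⊓ suc x) (m∸[m∸n]≡n i≤n) ⟩
    (n ∸ i) ⊓ suc i               ≡⟨ ⊓-comm (n ∸ i) (suc i) ⟩
    suc i ⊓ (n ∸ i)               ∎
  at-0 : cycleDist (suc n) i 0 ≡ i ⊓ suc (n ∸ i)
  at-0 = begin
    ∣ i - 0 ∣ ⊓ (suc n ∸ ∣ i - 0 ∣) ≡⟨ cong (λ x → x ⊓ (suc n ∸ x)) (∣-∣-identityʳ i) ⟩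
    i ⊓ (suc n ∸ i)                 ≡⟨ cong (i ⊓_) (+-∸-assoc 1 i≤n) ⟩
    i ⊓ suc (n ∸ i)                 ∎

near-cycleDist-step : ∀ {n i j} → i ≤ n → j ≤ n →
                      Near (cycleDist (suc n) i j) (cycleDist (suc n) i (suc j % suc n))
near-cycleDist-step {n} {i} {j} i≤n j≤n with m≤n⇒m<n∨m≡n j≤n
... | inj₁ j<n  rewrite m≤n⇒m%n≡m j<n  = near-cycleDist-suc (suc n) i j
... | inj₂ refl rewrite n%n≡0 (suc n) {{_}} = near-cycleDist-wrap i≤n

cycleDist-half : ∀ {h i j} → ∣ i - j ∣ ≡ h → cycleDist (h + h) i j ≡ h
cycleDist-half {h} e rewrite e | m+n∸m≡n h h = ⊓-idem h

cycleDist<half : ∀ {h i j} → i < h + h → j < h + h → ∣ i - j ∣ ≢ h → cycleDist (h + h) i j < h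
cycleDist<half {h} {i} {j} i<2h j<2h ∣i-j∣≢h with <-cmp ∣ i - j ∣ h
... | tri< ∣i-j∣<h _ _ = ≤-<-trans (m⊓n≤m _ _) ∣i-j∣<h
... | tri≈ _ ∣i-j∣≡h _ = ⊥-elim (∣i-j∣≢h ∣i-j∣≡h)
... | tri> _ _ h<∣i-j∣ =
  ≤-<-trans (m⊓n≤n _ _) (subst (h + h ∸ ∣ i - j ∣ <_) (m+n∸m≡n h h) (∸-monoʳ-< h<∣i-j∣ ∣i-j∣≤2h))
  where
  ∣i-j∣≤2h : ∣ i - j ∣ ≤ h + h
  ∣i-j∣≤2h = <⇒≤ (≤-<-trans (∣m-n∣≤m⊔n i j) (⊔-pres-<m i<2h j<2h))

∣m-n∣≡k⇒ : ∀ {m n k} → ∣ m - n ∣ ≡ k → n ≡ m + k ⊎ m ≡ n + k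
∣m-n∣≡k⇒ {m} {n} e with ≤-total m n
... | inj₁ m≤n = inj₁ (trans (sym (m+[n∸m]≡n m≤n)) (cong (m +_) (trans (sym (m≤n⇒∣m-n∣≡n∸m m≤n)) e)))
... | inj₂ n≤m = inj₂ (trans (sym (m+[n∸m]≡n n≤m)) (cong (n +_) (trans (sym (m≤n⇒∣n-m∣≡n∸m n≤m)) e)))

antipode-exists : ∀ {h i} → i < h + h → ∃[ j ] j < h + h × ∣ i - j ∣ ≡ h
antipode-exists {h} {i} i<2h with i <? h
... | yes i<h = i + h , +-monoˡ-< h i<h , ∣m-m+n∣≡n i h
... | no  i≮h = i ∸ h , ≤-<-trans (m∸n≤m i h) i<2h ,
                trans (m≤n⇒∣n-m∣≡n∸m (m∸n≤m i h)) (m∸[m∸n]≡n (≮⇒≥ i≮h))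

two-shifts⇒h+h≤ : ∀ {h i j k} → j ≡ i + h → i ≡ k + h → h + h ≤ j
two-shifts⇒h+h≤ {h} {i} {j} {k} j≡i+h i≡k+h = begin
  h + h       ≤⟨ m≤n+m (h + h) k ⟩
  k + (h + h) ≡⟨ +-assoc k h h ⟨
  k + h + h   ≡⟨ cong (_+ h) i≡k+h ⟨
  i + h       ≡⟨ j≡i+h ⟨
  j           ∎
  where open ≤-Reasoning

antipode-unique : ∀ {h i j k} → j < h + h → k < h + h → ∣ i - j ∣ ≡ h → ∣ i - k ∣ ≡ h → j ≡ k
antipode-unique {h} {i} {j} {k} j<2h k<2h ∣i-j∣≡h ∣i-k∣≡h with ∣m-n∣≡k⇒ {i} ∣i-j∣≡h | ∣m-n∣≡k⇒ {i} ∣i-k∣≡h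
... | inj₁ j≡i+h | inj₁ k≡i+h = trans j≡i+h (sym k≡i+h)
... | inj₂ i≡j+h | inj₂ i≡k+h = +-cancelʳ-≡ h j k (trans (sym i≡j+h) i≡k+h)
... | inj₁ j≡i+h | inj₂ i≡k+h = ⊥-elim (<⇒≱ j<2h (two-shifts⇒h+h≤ j≡i+h i≡k+h))
... | inj₂ i≡j+h | inj₁ k≡i+h = ⊥-elim (<⇒≱ k<2h (two-shifts⇒h+h≤ k≡i+h i≡j+h))

[1+m%n]%n≡[1+m]%n : ∀ m n .{{_ : NonZero n}} → suc (m % n) % n ≡ suc m % n
[1+m%n]%n≡[1+m]%n m n = begin
  (1 + m % n) % n         ≡⟨ %-distribˡ-+ 1 (m % n) n ⟩
  (1 % n + m % n % n) % n ≡⟨ cong (λ x → (1 % n + x) % n) (m%n%n≡m%n m n) ⟩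
  (1 % n + m % n) % n     ≡⟨ %-distribˡ-+ 1 m n ⟨
  (1 + m) % n             ∎
  where open ≡-Reasoning

module Cycle {n : ℕ} (G : Graph (suc n)) (σ : Fin (suc n) ↔ Fin (suc n))
             (σ-adj : ∀ u v → adj G u v ≡ cycleAdj (suc n) (Inverse.to σ u) (Inverse.to σ v)) where

  pos : Fin (suc n) → ℕ
  pos u = toℕ (Inverse.to σ u)

  pos≤n : ∀ u → pos u ≤ n
  pos≤n u = s≤s⁻¹ (toℕ<n (Inverse.to σ u))

  pos-injective : ∀ {u v} → pos u ≡ pos v → u ≡ v
  pos-injective = Injection.injective (↔⇒↣ σ) ∘ toℕ-injective

  vertexAt : ∀ i → i < suc n → Fin (suc n)
  vertexAt i i<1+n = Inverse.from σ (fromℕ< i<1+n)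

  pos-vertexAt : ∀ {i} (i<1+n : i < suc n) → pos (vertexAt i i<1+n) ≡ i
  pos-vertexAt i<1+n = trans (cong toℕ (Inverse.strictlyInverseˡ σ _)) (toℕ-fromℕ< i<1+n)

  pos⇒adj : ∀ {w v} → pos v ≡ suc (pos w) % suc n → T (adj G w v)
  pos⇒adj {w} {v} e = subst T (sym (σ-adj w v)) (Equivalence.from T-∨ (inj₁ (≡⇒≡ᵇ (pos v) _ e)))

  adj⇒pos : ∀ {w v} → T (adj G w v) → pos v ≡ suc (pos w) % suc n ⊎ pos w ≡ suc (pos v) % suc n
  adj⇒pos {w} {v} wv with Equivalence.to T-∨ (subst T (σ-adj w v) wv)
  ... | inj₁ e = inj₁ (≡ᵇ⇒≡ (pos v) _ e)
  ... | inj₂ e = inj₂ (≡ᵇ⇒≡ (pos w) _ e)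

  within-forward : ∀ k {u v} → pos v ≡ (pos u + k) % suc n → T (within G k u v)
  within-forward zero {u} {v} e = subst (T ∘ within G 0 u) (pos-injective pu≡pv) (within-refl G u)
    where
    pu≡pv : pos u ≡ pos v
    pu≡pv = sym (trans e (trans (cong (_% suc n) (+-identityʳ (pos u))) (m≤n⇒m%n≡m (pos≤n u))))
  within-forward (suc k) {u} {v} e =
    within-snoc G {k} {u} {w} {v} (within-forward k (pos-vertexAt w<1+n)) (pos⇒adj pv≡1+pw)
    where
    open ≡-Reasoning
    w<1+n : (pos u + k) % suc n < suc n
    w<1+n = m%n<n (pos u + k) (suc n)
    w : Fin (suc n)
    w = vertexAt _ w<1+n
    pv≡1+pw : pos v ≡ suc (pos w) % suc n
    pv≡1+pw = begin
      pos v                           ≡⟨ e ⟩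
      (pos u + suc k) % suc n         ≡⟨ cong (_% suc n) (+-suc (pos u) k) ⟩
      suc (pos u + k) % suc n         ≡⟨ [1+m%n]%n≡[1+m]%n (pos u + k) (suc n) ⟨
      suc ((pos u + k) % suc n) % suc n ≡⟨ cong (λ x → suc x % suc n) (pos-vertexAt w<1+n) ⟨
      suc (pos w) % suc n             ∎

  dist≤cycleDist-ordered : ∀ {u v} → pos u ≤ pos v → dist G u v ≤ cycleDist (suc n) (pos u) (pos v)
  dist≤cycleDist-ordered {u} {v} pu≤pv rewrite m≤n⇒∣m-n∣≡n∸m pu≤pv =
    ⊓-glb (dist-≤ G (within-forward δ {u} {v} forward))
          (subst (_≤ suc n ∸ δ) (dist-sym G v u) (dist-≤ G (within-forward (suc n ∸ δ) {v} {u} backward)))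
    where
    open ≡-Reasoning
    δ : ℕ
    δ = pos v ∸ pos u
    δ≤1+n : δ ≤ suc n
    δ≤1+n = ≤-trans (m∸n≤m (pos v) (pos u)) (m≤n⇒m≤1+n (pos≤n v))
    forward : pos v ≡ (pos u + δ) % suc n
    forward = sym (trans (cong (_% suc n) (m+[n∸m]≡n pu≤pv)) (m≤n⇒m%n≡m (pos≤n v)))
    backward : pos u ≡ (pos v + (suc n ∸ δ)) % suc n
    backward = sym (begin
      (pos v + (suc n ∸ δ)) % suc n         ≡⟨ cong (λ x → (x + (suc n ∸ δ)) % suc n) (m+[n∸m]≡n pu≤pv) ⟨
      (pos u + δ + (suc n ∸ δ)) % suc n     ≡⟨ cong (_% suc n) (+-assoc (pos u) δ (suc n ∸ δ)) ⟩
      (pos u + (δ + (suc n ∸ δ))) % suc n   ≡⟨ cong (λ x → (pos u + x) % suc n) (m+[n∸m]≡n δ≤1+n) ⟩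
      (pos u + suc n) % suc n               ≡⟨ [m+n]%n≡m%n (pos u) (suc n) ⟩
      pos u % suc n                         ≡⟨ m≤n⇒m%n≡m (pos≤n u) ⟩
      pos u                                 ∎)

  dist≤cycleDist : ∀ u v → dist G u v ≤ cycleDist (suc n) (pos u) (pos v)
  dist≤cycleDist u v with ≤-total (pos u) (pos v)
  ... | inj₁ pu≤pv = dist≤cycleDist-ordered pu≤pv
  ... | inj₂ pv≤pu = subst₂ _≤_ (dist-sym G v u) (cong (λ x → x ⊓ (suc n ∸ x)) (∣-∣-comm (pos v) (pos u)))
                            (dist≤cycleDist-ordered pv≤pu)

  near-adj : ∀ {i w v} → i ≤ n → T (adj G w v) →
             Near (cycleDist (suc n) i (pos v)) (cycleDist (suc n) i (pos w))
  near-adj {i} {w} {v} i≤n wv with adj⇒pos wv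
  ... | inj₁ e = near-sym (subst (Near _ ∘ cycleDist (suc n) i) (sym e) (near-cycleDist-step i≤n (pos≤n w)))
  ... | inj₂ e = subst (Near _ ∘ cycleDist (suc n) i) (sym e) (near-cycleDist-step i≤n (pos≤n v))

  cycleDist≤-within : ∀ k {u v} → T (within G k u v) → cycleDist (suc n) (pos u) (pos v) ≤ k
  cycleDist≤-within zero {u} {v} uv rewrite within-zero⁻ G {u} {v} uv | ∣n-n∣≡0 (pos v) = z≤n
  cycleDist≤-within (suc k) {u} {v} uv with within-suc⁻ G {k} {u} {v} uv
  ... | inj₁ uv′           = m≤n⇒m≤1+n (cycleDist≤-within k uv′)
  ... | inj₂ (w , uw , wv) = ≤-trans (proj₁ (near-adj (pos≤n u) wv)) (s≤s (cycleDist≤-within k uw))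

  dist≡cycleDist : ∀ u v → dist G u v ≡ cycleDist (suc n) (pos u) (pos v)
  dist≡cycleDist u v =
    ≤-antisym (dist≤cycleDist u v)
              (≤-dist G (λ k → cycleDist≤-within k) (cycleDist≤n (suc n) (pos u) (pos v)))

module EvenCycle {k : ℕ} (G : Graph (2 * suc k)) (σ : Fin (2 * suc k) ↔ Fin (2 * suc k))
                 (σ-adj : ∀ u v → adj G u v ≡ cycleAdj (2 * suc k) (Inverse.to σ u) (Inverse.to σ v)) where

  open Cycle G σ σ-adj

  h : ℕ
  h = suc k

  2h≡h+h : 2 * h ≡ h + h
  2h≡h+h = cong (h +_) (+-identityʳ h)

  pos<h+h : ∀ u → pos u < h + h
  pos<h+h u = subst (pos u <_) 2h≡h+h (s≤s (pos≤n u))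

  dist≡cycleDist-h+h : ∀ u v → dist G u v ≡ cycleDist (h + h) (pos u) (pos v)
  dist≡cycleDist-h+h u v = trans (dist≡cycleDist u v) (cong (λ N → cycleDist N (pos u) (pos v)) 2h≡h+h)

  antipodal : ∀ u → ∃[ a ] ∣ pos u - pos a ∣ ≡ h
  antipodal u with antipode-exists (pos<h+h u)
  ... | j , j<h+h , ∣i-j∣≡h =
    vertexAt j j<2h , subst (λ x → ∣ pos u - x ∣ ≡ h) (sym (pos-vertexAt j<2h)) ∣i-j∣≡h
    where
    j<2h : j < 2 * h
    j<2h = subst (j <_) (sym 2h≡h+h) j<h+h

  antipodal-unique : ∀ {u a v} → ∣ pos u - pos a ∣ ≡ h → ∣ pos u - pos v ∣ ≡ h → v ≡ a
  antipodal-unique {u} {a} {v} ua va =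
    pos-injective (antipode-unique {i = pos u} (pos<h+h v) (pos<h+h a) va ua)

  dist-antipodal : ∀ {u v} → ∣ pos u - pos v ∣ ≡ h → dist G u v ≡ h
  dist-antipodal {u} {v} e = trans (dist≡cycleDist-h+h u v) (cycleDist-half {i = pos u} {pos v} e)

  dist<h : ∀ {u v} → ∣ pos u - pos v ∣ ≢ h → dist G u v < h
  dist<h {u} {v} ne = subst (_< h) (sym (dist≡cycleDist-h+h u v)) (cycleDist<half (pos<h+h u) (pos<h+h v) ne)

  dist≤h : ∀ u v → dist G u v ≤ h
  dist≤h u v with ∣ pos u - pos v ∣ ≟ h
  ... | yes e = ≤-reflexive (dist-antipodal e)
  ... | no ne = <⇒≤ (dist<h ne)

  ecc≡h : ∀ u → ecc G u ≡ h
  ecc≡h u = ≤-antisym ecc≤h h≤ecc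
    where
    ecc≤h : ecc G u ≤ h
    ecc≤h = let (v , d≡e) = ecc-attained G u in subst (_≤ h) d≡e (dist≤h u v)
    h≤ecc : h ≤ ecc G u
    h≤ecc = let (a , ua) = antipodal u in subst (_≤ ecc G u) (dist-antipodal ua) (dist≤ecc G u a)

  eccMat-off-antipode : ∀ {u a v} → ∣ pos u - pos a ∣ ≡ h → v ≢ a → eccMat G u v ≡ 0
  eccMat-off-antipode {u} {a} {v} ua v≢a =
    eccMat-< G (subst (dist G u v <_) (sym ecc⊓ecc≡h) (dist<h (v≢a ∘ antipodal-unique ua)))
    where
    ecc⊓ecc≡h : ecc G u ⊓ ecc G v ≡ h
    ecc⊓ecc≡h rewrite ecc≡h u | ecc≡h v = ⊓-idem h

  2*Wecc≡totalEcc-evenCycle : 2 * Wecc G ≡ totalEcc G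
  2*Wecc≡totalEcc-evenCycle = 2*Wecc≡totalEcc G row-support
    where
    row-support : ∀ u → ∃[ a ] dist G u a ≡ ecc G u × (∀ v → v ≢ a → eccMat G u v ≡ 0)
    row-support u = let (a , ua) = antipodal u in
      a , trans (dist-antipodal ua) (sym (ecc≡h u)) , λ v → eccMat-off-antipode ua

evenCycle⇒2*Wecc≡totalEcc : ∀ {p} (G : Graph p) → IsEvenCycle G → 2 * Wecc G ≡ totalEcc G
evenCycle⇒2*Wecc≡totalEcc G (m , refl , σ , σ-adj) = EvenCycle.2*Wecc≡totalEcc-evenCycle {suc m} G σ σ-adj

theorem4p4 : {p : ℕ} (G : Graph p) → Connected G →
    (totalEcc G ≤ 2 * Wecc G) × (IsEvenCycle G → 2 * Wecc G ≡ totalEcc G)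
-- Connectivity is not used: the inequality only needs dist to be symmetric with ecc as its row
-- maximum, which also holds for the junk distance p between disconnected vertices.
theorem4p4 G _ = totalEcc≤2*Wecc G , evenCycle⇒2*Wecc≡totalEcc G
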